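{- Let $n\ge 2$ and let $G$ be a graph on $n$ vertices with $m$ edges. Then the graph $G\cup mK_2\cup(n^2-n-2m)K_1$ (disjoint union of $G$, $m$ copies of $K_2$, and $n^2-n-2m$ isolated vertices) belongs to $\mathcal{K}(n,n)$, i.e., after a suitable identification of its $n^2$ vertices with the pairs $(g_i,h_j)$, $1\le i,j\le n$, it lies in $\mathcal{K}(n,n)$.
   Context: All graphs are finite and simple; a graph is nontrivial if it has at least one edge. $\cup$ denotes disjoint union of graphs. The tensor product $G\otimes H$ has vertex set $V(G)\times V(H)$, with $\{(g,h),(g',h')\}$ an edge iff $\{g,g'\}\in E(G)$ and $\{h,h'\}\in E(H)$. For graphs on a common vertex set, the 2-sum $G\oplus H$ is the graph on that vertex set whose edge set is the symmetric difference of $E(G)$ and $E(H)$. For integers $p,q\ge2$, $\mathcal{K}(p,q)$ is the set of graphs $K$ on vertex set $\{(g_i,h_j)\mid 1\le i\le p,1\le j\le q\}$ such that $K=\bigoplus_{k=1}^{l}(G_k\otimes H_k)$ for some positive integer $l$, nontrivial graphs $G_k$ on $\{g_1,\dots,g_p\}$ and nontrivial graphs $H_k$ on $\{h_1,\dots,h_q\}$. -}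

module Defs where

open import Data.Bool using (Bool; true; false; _∧_; _xor_; not; if_then_else_)
open import Data.Nat using (ℕ; _+_; _*_; _∸_; _<ᵇ_)
open import Data.Fin using (Fin; toℕ)
open import Data.Fin.Properties renaming (_≟_ to _≟ᶠ_)
open import Data.List using (List; []; _∷_; foldr; map; allFin)
open import Data.Nat.ListAction using (sum)
open import Data.List.Relation.Unary.All using (All)
open import Data.Product using (Σ; _×_; _,_; proj₁; proj₂; ∃; ∃-syntax)
open import Data.Sum using (_⊎_; inj₁; inj₂)
open import Relation.Binary.PropositionalEquality using (_≡_)
open import Relation.Nullary.Decidable using (⌊_⌋)
open import Function.Bundles using (Inverse; _↔_)

record Graph (V : Set) : Set where
  field
    adj    : V → V → Bool
    sym    : ∀ x y → adj x y ≡ adj y x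
    irrefl : ∀ x → adj x x ≡ false
open Graph public

Nontrivial : {V : Set} → Graph V → Set
Nontrivial {V} G = ∃[ x ] ∃[ y ] adj G x y ≡ true

numEdges : {n : ℕ} → Graph (Fin n) → ℕ
numEdges {n} G =
  sum (map (λ i → sum (map (λ j → if (toℕ i <ᵇ toℕ j) ∧ adj G i j then 1 else 0)
                           (allFin n)))
           (allFin n))

tensorAdj : {p q : ℕ} → Graph (Fin p) → Graph (Fin q) →
            Fin p × Fin q → Fin p × Fin q → Bool
tensorAdj G H (g , h) (g' , h') = adj G g g' ∧ adj H h h'

-- adjacency of the 2-sum (symmetric difference of edge sets) of the G_k ⊗ H_k
twoSumAdj : {p q : ℕ} → List (Graph (Fin p) × Graph (Fin q)) →
            Fin p × Fin q → Fin p × Fin q → Bool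
twoSumAdj L x y = foldr (λ GH b → tensorAdj (proj₁ GH) (proj₂ GH) x y xor b) false L

-- K ∈ 𝒦(p,q): K = ⊕_{k=1}^l (G_k ⊗ H_k), l ≥ 1, all G_k, H_k nontrivial
-- (vertex (g_i,h_j) is represented by (i , j) : Fin p × Fin q)
InK : (p q : ℕ) → Graph (Fin p × Fin q) → Set
InK p q K =
  ∃[ GH ] ∃[ L ]
    let terms = GH ∷ L in
    All (λ P → Nontrivial (proj₁ P) × Nontrivial (proj₂ P)) terms ×
    (∀ x y → adj K x y ≡ twoSumAdj terms x y)

UnionV : (n m : ℕ) → Set
UnionV n m = Fin n ⊎ (Fin m × Bool) ⊎ Fin (n * n ∸ n ∸ 2 * m)

unionAdj : {n : ℕ} (G : Graph (Fin n)) (m : ℕ) → UnionV n m → UnionV n m → Bool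
unionAdj G m (inj₁ i) (inj₁ j) = adj G i j
unionAdj G m (inj₂ (inj₁ (i , b))) (inj₂ (inj₁ (j , b'))) = ⌊ i ≟ᶠ j ⌋ ∧ (b xor b')
unionAdj G m _ _ = false

IsoTo : {W V : Set} → Graph W → (V → V → Bool) → Set
IsoTo {W} {V} K a =
  Σ (W ↔ V) (λ f → ∀ x y → adj K x y ≡ a (Inverse.to f x) (Inverse.to f y))

module Submission where

-- Identify the n² vertices (i , j) of 𝒦(n,n) with ordered pairs of
-- vertices of G.  For every edge {i,j} of G (stored as i < j) the tensor square
-- E ⊗ E of the one-edge graph E = K₂(i,j) has exactly the two edges
-- (i,i)–(j,j) and (i,j)–(j,i); these squares are edge-disjoint, so their 2-sum K
-- is the graph in which (a,c) ~ (b,d) iff ab ∈ E(G) and (c,d) is (a,b) or (b,a)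
-- ("Linked").  Two extra copies of one fixed square cancel in the 2-sum and make
-- the list of summands nonempty even when G has no edges.  Under the bijection
--   diagonal (a,a) ↦ a ∈ G,   (i,j),(j,i) for an edge i < j ↦ the two ends of a K₂,
--   all other pairs ↦ isolated vertices,
-- K becomes G ∪ mK₂ ∪ (n²-n-2m)K₁.

open import Defs
open import Data.Bool using (Bool; true; false; T; not; _∧_; _∨_; _xor_; if_then_else_)
open import Data.Bool.Properties using (T-≡; T-∧; T-∨; T-irrelevant; ⇔→≡; xor-assoc; xor-same)
open import Data.Empty using (⊥-elim)
open import Data.Fin using (Fin; zero; suc; toℕ; _<_)
open import Data.Fin.Properties using (_≟_; 0≢1+n; suc-injective; <-cmp; <-asym; <⇒≢; +↔⊎; *↔×; 2↔Bool)
open import Data.Fin.Permutation using (↔⇒≡)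
open import Data.List using (List; []; _∷_; foldr; map; tabulate; allFin)
open import Data.List.Properties using (map-tabulate)
open import Data.List.Relation.Unary.All using (_∷_)
open import Data.List.Relation.Unary.All.Properties using (tabulate⁺)
open import Data.Nat using (ℕ; zero; suc; _+_; _*_; _∸_; _<ᵇ_; _≤_; s≤s; z≤n)
open import Data.Nat.ListAction using (sum)
open import Data.Nat.Properties using (<ᵇ⇒<; <⇒<ᵇ; m+n∸m≡n; *-comm)
open import Data.Product using (Σ; Σ-syntax; ∃-syntax; _×_; _,_; proj₁; proj₂; swap; uncurry)
open import Data.Product.Properties using (≡-dec)
open import Data.Product.Algebra using (Σ-assoc; ×-cong)
open import Data.Sum using (_⊎_; inj₁; inj₂; [_,_]′)
open import Data.Sum.Algebra using (⊎-cong)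
open import Function using (_∘_; id)
open import Function.Bundles using (Inverse; Injection; Equivalence; _↔_; _⇔_; mk↔ₛ′; mk⇔)
open import Function.Properties.Inverse using (↔-refl; ↔-sym; ↔-trans; ↔⇒↣)
open import Function.Construct.Composition using () renaming (equivalence to ⇔-trans)
open import Function.Construct.Symmetry using (⇔-sym)
open import Function.Related.TypeIsomorphisms using (Σ-distribˡ-⊎)
open import Relation.Binary.Definitions using (tri<; tri≈; tri>)
open import Relation.Binary.PropositionalEquality
  using (_≡_; _≢_; refl; trans; cong; cong₂; subst; subst₂; module ≡-Reasoning)
  renaming (sym to ≡-sym)
open import Relation.Nullary using (¬_; Dec)
open import Relation.Nullary.Decidable using (⌊_⌋; toWitness; fromWitness; toWitnessFalse; fromWitnessFalse)

∧-intro : {a b : Bool} → T a → T b → T (a ∧ b)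
∧-intro p q = Equivalence.from T-∧ (p , q)

∧-elim : {a b : Bool} → T (a ∧ b) → T a × T b
∧-elim = Equivalence.to T-∧

T-not : {b : Bool} → T (not b) ⇔ (¬ T b)
T-not {false} = mk⇔ (λ _ ()) (λ _ → _)
T-not {true}  = mk⇔ (λ ()) (λ ¬t → ¬t _)

T-⇔⇒≡ : {b c : Bool} → T b ⇔ T c → b ≡ c
T-⇔⇒≡ h = ⇔→≡ (⇔-trans (⇔-sym T-≡) (⇔-trans h T-≡))

¬T⇒≡false : {b : Bool} → ¬ T b → b ≡ false
¬T⇒≡false {false} _  = refl
¬T⇒≡false {true}  ¬t = ⊥-elim (¬t _)

-- T b is a proposition, so logically equivalent T's are isomorphic.
T-⇔⇒↔ : {b c : Bool} → T b ⇔ T c → T b ↔ T c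
T-⇔⇒↔ h = mk↔ₛ′ (Equivalence.to h) (Equivalence.from h) (λ _ → T-irrelevant _ _) (λ _ → T-irrelevant _ _)

T-xor : {β β' : Bool} → T (β xor β') ⇔ (β' ≡ not β)
T-xor {false} {false} = mk⇔ (λ ()) (λ ())
T-xor {false} {true}  = mk⇔ (λ _ → refl) (λ _ → _)
T-xor {true}  {false} = mk⇔ (λ _ → refl) (λ _ → _)
T-xor {true}  {true}  = mk⇔ (λ ()) (λ ())

k₂-adjacency : {m : ℕ} (k k' : Fin m) (β β' : Bool) → T (⌊ k ≟ k' ⌋ ∧ (β xor β')) ⇔ (k' ≡ k × β' ≡ not β)
k₂-adjacency k k' β β' = mk⇔
  (λ t → let (e , x) = ∧-elim {⌊ k ≟ k' ⌋} t in ≡-sym (toWitness e) , Equivalence.to T-xor x)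
  (λ { (refl , refl) → ∧-intro (fromWitness {a? = k ≟ k} refl) (Equivalence.from (T-xor {β}) refl) })

xor-elim : (a r : Bool) → T (a xor r) → T a ⊎ T r
xor-elim true  r _ = inj₁ _
xor-elim false r t = inj₂ t

xor-introˡ : {a r : Bool} → T a → ¬ T r → T (a xor r)
xor-introˡ {true} {false} _ _  = _
xor-introˡ {true} {true}  _ ¬r = ¬r _

xor-introʳ : {a r : Bool} → ¬ T a → T r → T (a xor r)
xor-introʳ {false} _  t = t
xor-introʳ {true}  ¬a _ = ⊥-elim (¬a _)

Σ-congʳ : {A : Set} {P Q : A → Set} → (∀ x → P x ↔ Q x) → Σ A P ↔ Σ A Q
Σ-congʳ f = mk↔ₛ′ (λ (x , p) → x , Inverse.to (f x) p) (λ (x , q) → x , Inverse.from (f x) q)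
  (λ (x , q) → cong (x ,_) (Inverse.strictlyInverseˡ (f x) q))
  (λ (x , p) → cong (x ,_) (Inverse.strictlyInverseʳ (f x) p))

subset-≡ : {A : Set} {b : A → Bool} {x y : Σ A (T ∘ b)} → proj₁ x ≡ proj₁ y → x ≡ y
subset-≡ {x = x , p} {y = .x , q} refl = cong (x ,_) (T-irrelevant p q)

refine : {A : Set} (b c : A → Bool) →
  Σ A (λ x → T (b x)) ↔ (Σ A (λ x → T (b x ∧ c x)) ⊎ Σ A (λ x → T (b x ∧ not (c x))))
refine b c = ↔-trans (Σ-congʳ (λ x → pointwise (b x) (c x))) Σ-distribˡ-⊎
  where
  pointwise : (u v : Bool) → T u ↔ (T (u ∧ v) ⊎ T (u ∧ not v))
  pointwise false v     = mk↔ₛ′ (λ ()) (λ { (inj₁ ()) ; (inj₂ ()) }) (λ { (inj₁ ()) ; (inj₂ ()) }) (λ ())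
  pointwise true  true  = mk↔ₛ′ inj₁ (λ { (inj₁ t) → t ; (inj₂ ()) }) (λ { (inj₁ _) → refl ; (inj₂ ()) }) (λ _ → refl)
  pointwise true  false = mk↔ₛ′ inj₂ (λ { (inj₁ ()) ; (inj₂ t) → t }) (λ { (inj₁ ()) ; (inj₂ _) → refl }) (λ _ → refl)

split : {A : Set} (c : A → Bool) → A ↔ (Σ A (λ x → T (c x)) ⊎ Σ A (λ x → T (not (c x))))
split c = ↔-trans (mk↔ₛ′ (_, _) proj₁ (λ _ → refl) (λ _ → refl)) (refine (λ _ → true) c)

Σ-swap : {A B : Set} {P : B × A → Set} → Σ (A × B) (P ∘ swap) ↔ Σ (B × A) P
Σ-swap = mk↔ₛ′ (λ (p , t) → swap p , t) (λ (p , t) → swap p , t) (λ _ → refl) (λ _ → refl)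

⊎-self↔×Bool : {A : Set} → (A ⊎ A) ↔ (A × Bool)
⊎-self↔×Bool {A} = mk↔ₛ′ to from (λ { (_ , false) → refl ; (_ , true) → refl }) (λ { (inj₁ _) → refl ; (inj₂ _) → refl })
  where
  to : A ⊎ A → A × Bool
  to (inj₁ a) = a , false
  to (inj₂ a) = a , true
  from : A × Bool → A ⊎ A
  from (a , false) = inj₁ a
  from (a , true)  = inj₂ a

Σ-Fin-suc : {k : ℕ} (F : Fin (suc k) → Set) → Σ (Fin (suc k)) F ↔ (F zero ⊎ Σ (Fin k) (F ∘ suc))
Σ-Fin-suc {k} F = mk↔ₛ′ to from (λ { (inj₁ _) → refl ; (inj₂ _) → refl }) (λ { (zero , _) → refl ; (suc _ , _) → refl })
  where
  to : Σ (Fin (suc k)) F → F zero ⊎ Σ (Fin k) (F ∘ suc)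
  to (zero  , x) = inj₁ x
  to (suc i , x) = inj₂ (i , x)
  from : F zero ⊎ Σ (Fin k) (F ∘ suc) → Σ (Fin (suc k)) F
  from (inj₁ x)       = zero , x
  from (inj₂ (i , x)) = suc i , x

Σ-Fin-sum : {k : ℕ} (F : Fin k → Set) (c : Fin k → ℕ) →
  (∀ i → F i ↔ Fin (c i)) → Σ (Fin k) F ↔ Fin (sum (map c (allFin k)))
Σ-Fin-sum {k} F c f = subst (λ s → Σ (Fin k) F ↔ Fin s) (cong sum (≡-sym (map-tabulate id c))) (go F c f)
  where
  go : {k : ℕ} (F : Fin k → Set) (c : Fin k → ℕ) → (∀ i → F i ↔ Fin (c i)) → Σ (Fin k) F ↔ Fin (sum (tabulate c))
  go {zero}  F c f = mk↔ₛ′ (λ ()) (λ ()) (λ ()) (λ ())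
  go {suc k} F c f =
    ↔-trans (Σ-Fin-suc F) (↔-trans (⊎-cong (f zero) (go (F ∘ suc) (c ∘ suc) (f ∘ suc))) (↔-sym +↔⊎))

T↔Fin : (b : Bool) → T b ↔ Fin (if b then 1 else 0)
T↔Fin false = mk↔ₛ′ (λ ()) (λ ()) (λ ()) (λ ())
T↔Fin true  = mk↔ₛ′ (λ _ → zero) (λ _ → _) (λ { zero → refl ; (suc ()) }) (λ _ → refl)

-- The pairs (i , j) satisfying a test q, and their number (numEdges is of this form).
PairsWhere : {a b : ℕ} → (Fin a → Fin b → Bool) → Set
PairsWhere q = Σ (Fin _ × Fin _) (λ p → T (uncurry q p))

count : {a b : ℕ} → (Fin a → Fin b → Bool) → ℕ
count {a} {b} q = sum (map (λ i → sum (map (λ j → if q i j then 1 else 0) (allFin b))) (allFin a))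

PairsWhere↔count : {a b : ℕ} (q : Fin a → Fin b → Bool) → PairsWhere q ↔ Fin (count q)
PairsWhere↔count q = ↔-trans Σ-assoc (Σ-Fin-sum _ _ (λ i → Σ-Fin-sum _ _ (λ j → T↔Fin (q i j))))

orient : {A : Set} → Bool → A × A → A × A
orient false p = p
orient true  p = swap p

Orients : {A : Set} → A × A → A × A → Set
Orients u p = ∃[ β ] u ≡ orient β p

orient-swap : {A : Set} (β : Bool) (p : A × A) → swap (orient β p) ≡ orient (not β) p
orient-swap false p = refl
orient-swap true  p = refl

orient-orient : {A : Set} (β γ : Bool) (p : A × A) → orient β (orient γ p) ≡ orient (β xor γ) p
orient-orient false γ     p = refl
orient-orient true  false p = refl
orient-orient true  true  p = refl

orients-sym : {A : Set} {u p : A × A} → Orients u p → Orients p u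
orients-sym {p = p} (β , refl) = β , ≡-sym (trans (orient-orient β β p) (cong (λ γ → orient γ p) (xor-same β)))

orients-trans : {A : Set} {u v p : A × A} → Orients u v → Orients v p → Orients u p
orients-trans {p = p} (β , refl) (γ , refl) = β xor γ , orient-orient β γ p

orients-swap : {A : Set} {u p : A × A} → Orients u p → Orients (swap u) p
orients-swap {p = p} (β , refl) = not β , orient-swap β p

orients-of-≡ : {A : Set} {u v : A × A} (β γ : Bool) → orient β u ≡ orient γ v → Orients u v
orients-of-≡ β γ eq = orients-trans (orients-sym (β , refl)) (γ , eq)

orients-diag : {A : Set} {u i j : A} → Orients (u , u) (i , j) → i ≡ j
orients-diag (false , refl) = refl
orients-diag (true  , refl) = refl

orient-cancel : {A : Set} {i j : A} (β γ : Bool) → i ≢ j → orient β (i , j) ≡ orient γ (i , j) → β ≡ γ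
orient-cancel false false _  _  = refl
orient-cancel true  true  _  _  = refl
orient-cancel false true  ne eq = ⊥-elim (ne (cong proj₁ eq))
orient-cancel true  false ne eq = ⊥-elim (ne (cong proj₂ eq))

increasing-unique : {n : ℕ} {i j i' j' : Fin n} → i < j → i' < j' →
  Orients (i , j) (i' , j') → (i , j) ≡ (i' , j')
increasing-unique _   _    (false , eq)   = eq
increasing-unique i<j i'<j' (true , refl) = ⊥-elim (<-asym i<j i'<j')

_≟ₚ_ : {n : ℕ} (p q : Fin n × Fin n) → Dec (p ≡ q)
_≟ₚ_ = ≡-dec _≟_ _≟_

edgeTest : {n : ℕ} (i j u v : Fin n) → Bool
edgeTest i j u v = ⌊ (u , v) ≟ₚ (i , j) ⌋ ∨ ⌊ (u , v) ≟ₚ (j , i) ⌋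

edgeTest-orients : {n : ℕ} (i j u v : Fin n) → T (edgeTest i j u v) ⇔ Orients (u , v) (i , j)
edgeTest-orients i j u v = mk⇔
  (λ t → [ (λ e → false , toWitness e) , (λ e → true , toWitness e) ]′ (Equivalence.to (T-∨ {x}) t))
  (λ { (false , e) → Equivalence.from (T-∨ {x}) (inj₁ (fromWitness e))
     ; (true  , e) → Equivalence.from (T-∨ {x}) (inj₂ (fromWitness e)) })
  where
  x : Bool
  x = ⌊ (u , v) ≟ₚ (i , j) ⌋

edgeGraph : {n : ℕ} (i j : Fin n) → i ≢ j → Graph (Fin n)
edgeGraph i j i≢j = record { adj = edgeTest i j ; sym = test-sym ; irrefl = test-irrefl }
  where
  test-sym : ∀ u v → edgeTest i j u v ≡ edgeTest i j v u
  test-sym u v = T-⇔⇒≡ (mk⇔ (flipped u v) (flipped v u))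
    where
    flipped : ∀ u v → T (edgeTest i j u v) → T (edgeTest i j v u)
    flipped u v t = Equivalence.from (edgeTest-orients i j v u) (orients-swap (Equivalence.to (edgeTest-orients i j u v) t))
  test-irrefl : ∀ u → edgeTest i j u u ≡ false
  test-irrefl u = ¬T⇒≡false (λ t → i≢j (orients-diag (Equivalence.to (edgeTest-orients i j u u) t)))

edgeGraph-nontrivial : {n : ℕ} {i j : Fin n} (i≢j : i ≢ j) → Nontrivial (edgeGraph i j i≢j)
edgeGraph-nontrivial {i = i} {j} i≢j = i , j , Equivalence.to T-≡ (Equivalence.from (edgeTest-orients i j i j) (false , refl))

twoSumGraph : {p q : ℕ} → List (Graph (Fin p) × Graph (Fin q)) → Graph (Fin p × Fin q)
twoSumGraph L = record { adj = twoSumAdj L ; sym = twoSum-sym L ; irrefl = twoSum-irrefl L }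
  where
  twoSum-sym : ∀ L x y → twoSumAdj L x y ≡ twoSumAdj L y x
  twoSum-sym []            x       y         = refl
  twoSum-sym ((G , H) ∷ L) (g , h) (g' , h') =
    cong₂ _xor_ (cong₂ _∧_ (Graph.sym G g g') (Graph.sym H h h')) (twoSum-sym L _ _)
  twoSum-irrefl : ∀ L x → twoSumAdj L x x ≡ false
  twoSum-irrefl []            x       = refl
  twoSum-irrefl ((G , H) ∷ L) (g , h) = cong₂ _xor_ (cong (_∧ adj H h h) (Graph.irrefl G g)) (twoSum-irrefl L _)

twoSum-cancel : {p q : ℕ} (t : Graph (Fin p) × Graph (Fin q)) (L : List (Graph (Fin p) × Graph (Fin q))) →
  ∀ x y → twoSumAdj (t ∷ t ∷ L) x y ≡ twoSumAdj L x y
twoSum-cancel (G , H) L x y = trans (≡-sym (xor-assoc a a _)) (cong (_xor twoSumAdj L x y) (xor-same a))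
  where
  a : Bool
  a = tensorAdj G H x y

xor-tabulate⇒ : {A : Set} {k : ℕ} (f : A → Bool) (h : Fin k → A) →
  T (foldr (λ a r → f a xor r) false (tabulate h)) → ∃[ i ] T (f (h i))
xor-tabulate⇒ {k = zero}  f h ()
xor-tabulate⇒ {k = suc k} f h t with xor-elim (f (h zero)) _ t
... | inj₁ t₀ = zero , t₀
... | inj₂ t  = let (i , tᵢ) = xor-tabulate⇒ f (h ∘ suc) t in suc i , tᵢ

xor-tabulate⇐ : {A : Set} {k : ℕ} (f : A → Bool) (h : Fin k → A) →
  (∀ i j → T (f (h i)) → T (f (h j)) → i ≡ j) →
  ∃[ i ] T (f (h i)) → T (foldr (λ a r → f a xor r) false (tabulate h))
xor-tabulate⇐ f h unique (zero , t₀) = xor-introˡ t₀ λ t →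
  let (i , tᵢ) = xor-tabulate⇒ f (h ∘ suc) t in 0≢1+n (unique zero (suc i) t₀ tᵢ)
xor-tabulate⇐ f h unique (suc i , tᵢ) = xor-introʳ (λ t₀ → 0≢1+n (unique zero (suc i) t₀ tᵢ))
  (xor-tabulate⇐ f (h ∘ suc) (λ i j tᵢ tⱼ → suc-injective (unique (suc i) (suc j) tᵢ tⱼ)) (i , tᵢ))

module Construction {n : ℕ} (G : Graph (Fin n)) where

  Pair : Set
  Pair = Fin n × Fin n

  same below isEdge isRest : Fin n → Fin n → Bool
  same   i j = ⌊ i ≟ j ⌋
  below  i j = toℕ i <ᵇ toℕ j
  isEdge i j = below i j ∧ adj G i j
  isRest i j = not (same i j) ∧ not (adj G i j)

  -- Edges {i , j} of G, stored with i < j, and the pairs that become isolated vertices.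
  Edge Rest : Set
  Edge = PairsWhere isEdge
  Rest = PairsWhere isRest

  m : ℕ
  m = numEdges G

  edge↔ : Edge ↔ Fin m
  edge↔ = PairsWhere↔count isEdge

  edgeAt : Fin m → Edge
  edgeAt = Inverse.from edge↔

  adj-sym : {a b : Fin n} → T (adj G a b) → T (adj G b a)
  adj-sym {a} {b} = subst T (Graph.sym G a b)

  adj-irrefl : {a : Fin n} → ¬ T (adj G a a)
  adj-irrefl {a} = subst T (Graph.irrefl G a)

  adj-orients : {u p : Pair} → Orients u p → T (uncurry (adj G) p) → T (uncurry (adj G) u)
  adj-orients (false , refl) t = t
  adj-orients (true  , refl) t = adj-sym t

  T-below : {i j : Fin n} → T (below i j) ⇔ i < j
  T-below = mk⇔ (<ᵇ⇒< _ _) <⇒<ᵇ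

  edge-increasing : (ε : Edge) → proj₁ (proj₁ ε) < proj₂ (proj₁ ε)
  edge-increasing (_ , t) = Equivalence.to T-below (proj₁ (∧-elim t))

  edge-adjacent : (ε : Edge) → T (uncurry (adj G) (proj₁ ε))
  edge-adjacent (_ , t) = proj₂ (∧-elim t)

  edge-of : {a b : Fin n} → T (adj G a b) → Σ[ ε ∈ Edge ] Orients (a , b) (proj₁ ε)
  edge-of {a} {b} t with <-cmp a b
  ... | tri< a<b _ _ = ((a , b) , ∧-intro (<⇒<ᵇ a<b) t) , false , refl
  ... | tri≈ _ refl _ = ⊥-elim (adj-irrefl t)
  ... | tri> _ _ b<a = ((b , a) , ∧-intro (<⇒<ᵇ b<a) (adj-sym t)) , true , refl

  edgeAt-unique : {k k' : Fin m} → Orients (proj₁ (edgeAt k)) (proj₁ (edgeAt k')) → k ≡ k'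
  edgeAt-unique {k} {k'} o = Injection.injective (↔⇒↣ (↔-sym edge↔))
    (subset-≡ (increasing-unique (edge-increasing (edgeAt k)) (edge-increasing (edgeAt k')) o))

  diagonal↔ : PairsWhere same ↔ Fin n
  diagonal↔ = mk↔ₛ′ (proj₁ ∘ proj₁) (λ a → (a , a) , fromWitness refl) (λ _ → refl) back
    where
    back : (d : PairsWhere same) → ((proj₁ (proj₁ d) , proj₁ (proj₁ d)) , fromWitness refl) ≡ d
    back ((a , c) , t) with toWitness t
    ... | refl = cong ((a , a) ,_) (T-irrelevant _ t)

  orientations↔ : PairsWhere (λ i j → not (same i j) ∧ adj G i j) ↔ (Edge × Bool)
  orientations↔ =
    ↔-trans (refine _ (uncurry below)) (↔-trans (⊎-cong increasing decreasing) ⊎-self↔×Bool)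
    where
    increasing : Σ Pair (λ (i , j) → T ((not (same i j) ∧ adj G i j) ∧ below i j)) ↔ Edge
    increasing = Σ-congʳ (λ (i , j) → T-⇔⇒↔ (mk⇔ (forget i j) (remember i j)))
      where
      forget : ∀ i j → T ((not (same i j) ∧ adj G i j) ∧ below i j) → T (isEdge i j)
      forget i j t = let (d∧a , l) = ∧-elim {not (same i j) ∧ adj G i j} t in
        ∧-intro l (proj₂ (∧-elim {not (same i j)} d∧a))
      remember : ∀ i j → T (isEdge i j) → T ((not (same i j) ∧ adj G i j) ∧ below i j)
      remember i j t = let (l , a) = ∧-elim {below i j} t in
        ∧-intro (∧-intro (fromWitnessFalse (<⇒≢ (Equivalence.to T-below l))) a) l
    decreasing : Σ Pair (λ (i , j) → T ((not (same i j) ∧ adj G i j) ∧ not (below i j))) ↔ Edge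
    decreasing = ↔-trans (Σ-congʳ (λ (i , j) → T-⇔⇒↔ (mk⇔ (turn i j) (unturn i j)))) Σ-swap
      where
      turn : ∀ i j → T ((not (same i j) ∧ adj G i j) ∧ not (below i j)) → T (isEdge j i)
      turn i j t with ∧-elim {not (same i j) ∧ adj G i j} t
      ... | d∧a , nl with ∧-elim {not (same i j)} d∧a | <-cmp i j
      ...   | _ , _ | tri< i<j _ _ = ⊥-elim (Equivalence.to T-not nl (<⇒<ᵇ i<j))
      ...   | d , _ | tri≈ _ i≡j _ = ⊥-elim (toWitnessFalse d i≡j)
      ...   | _ , a | tri> _ _ j<i = ∧-intro (<⇒<ᵇ j<i) (adj-sym a)
      unturn : ∀ i j → T (isEdge j i) → T ((not (same i j) ∧ adj G i j) ∧ not (below i j))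
      unturn i j t = let (l , a) = ∧-elim {below j i} t ; j<i = Equivalence.to T-below l in
        ∧-intro (∧-intro (fromWitnessFalse {a? = i ≟ j} (<⇒≢ j<i ∘ ≡-sym)) (adj-sym a))
                (Equivalence.from T-not (<-asym j<i ∘ Equivalence.to (T-below {i} {j})))

  pairs↔parts : Pair ↔ (Fin n ⊎ (Edge × Bool) ⊎ Rest)
  pairs↔parts = ↔-trans (split (uncurry same))
    (⊎-cong diagonal↔ (↔-trans (refine _ (uncurry (adj G))) (⊎-cong orientations↔ ↔-refl)))

  -- Counting the pairs in two ways determines the number of isolated vertices.
  rest-size : count isRest ≡ n * n ∸ n ∸ 2 * m
  rest-size = ≡-sym (begin
      n * n ∸ n ∸ 2 * m            ≡⟨ cong (λ s → s ∸ n ∸ 2 * m) pairs-count ⟩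
      n + (m * 2 + r) ∸ n ∸ 2 * m  ≡⟨ cong (_∸ 2 * m) (m+n∸m≡n n (m * 2 + r)) ⟩
      m * 2 + r ∸ 2 * m            ≡⟨ cong (λ s → s + r ∸ 2 * m) (*-comm m 2) ⟩
      2 * m + r ∸ 2 * m            ≡⟨ m+n∸m≡n (2 * m) r ⟩
      r                            ∎)
    where
    open ≡-Reasoning
    r : ℕ
    r = count isRest
    parts↔Fin : (Fin n ⊎ (Fin m × Bool) ⊎ Fin r) ↔ Fin (n + (m * 2 + r))
    parts↔Fin = ↔-sym (↔-trans +↔⊎ (⊎-cong ↔-refl
      (↔-trans +↔⊎ (⊎-cong (↔-trans *↔× (×-cong ↔-refl 2↔Bool)) ↔-refl))))
    pairs-count : n * n ≡ n + (m * 2 + r)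
    pairs-count = ↔⇒≡ (↔-trans *↔× (↔-trans pairs↔parts
      (↔-trans (⊎-cong ↔-refl (⊎-cong (×-cong edge↔ ↔-refl) (PairsWhere↔count isRest))) parts↔Fin)))

  rest↔ : Rest ↔ Fin (n * n ∸ n ∸ 2 * m)
  rest↔ = subst (λ s → Rest ↔ Fin s) rest-size (PairsWhere↔count isRest)

  vertices↔ : Pair ↔ UnionV n m
  vertices↔ = ↔-trans pairs↔parts (⊎-cong ↔-refl (⊎-cong (×-cong edge↔ ↔-refl) rest↔))

  vertex : UnionV n m → Pair
  vertex = Inverse.from vertices↔

  -- The adjacency shared by the 2-sum K and the union graph:
  -- (a , c) ~ (b , d) iff ab is an edge of G and (c , d) is (a , b) or (b , a).
  Linked : Pair → Pair → Set
  Linked (a , c) (b , d) = T (adj G a b) × Orients (c , d) (a , b)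

  OffDiagonal : Pair → Set
  OffDiagonal (a , c) = a ≢ c

  Linked-sym : {x y : Pair} → Linked x y → Linked y x
  Linked-sym (t , false , refl) = adj-sym t , false , refl
  Linked-sym (t , true  , refl) = adj-sym t , true  , refl

  Linked-diag : {a : Fin n} {y : Pair} → Linked (a , a) y → ¬ OffDiagonal y
  Linked-diag (_ , false , refl) off = off refl
  Linked-diag (_ , true  , refl) off = off refl

  Linked-offdiag : {x y : Pair} → OffDiagonal x → Linked x y → y ≡ swap x × T (uncurry (adj G) x)
  Linked-offdiag off (_ , false , refl) = ⊥-elim (off refl)
  Linked-offdiag off (t , true  , refl) = refl , t

  orient-offdiag : {p : Pair} (β : Bool) → OffDiagonal p → OffDiagonal (orient β p)
  orient-offdiag false off = off
  orient-offdiag true  off = off ∘ ≡-sym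

  edge-offdiag : (ε : Edge) → OffDiagonal (proj₁ ε)
  edge-offdiag ε = <⇒≢ (edge-increasing ε)

  rest-pair : (ρ : Rest) → OffDiagonal (proj₁ ρ) × ¬ T (uncurry (adj G) (proj₁ ρ))
  rest-pair ((i , j) , t) = let (d , na) = ∧-elim {not (same i j)} t in toWitnessFalse d , Equivalence.to T-not na

  orientations-linked : (ε : Edge) (β : Bool) → Linked (orient β (proj₁ ε)) (orient (not β) (proj₁ ε))
  orientations-linked ε false = edge-adjacent ε , true , refl
  orientations-linked ε true  = adj-sym (edge-adjacent ε) , true , refl

  -- The 2-sum side: the summand for an edge is the tensor square of K₂ on it,
  -- which joins x and y ("Covers") iff both coordinate pairs orient the edge.
  gadget : Edge → Graph (Fin n)
  gadget ε = edgeGraph _ _ (edge-offdiag ε)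

  Covers : Edge → Pair → Pair → Set
  Covers ε x y = T (tensorAdj (gadget ε) (gadget ε) x y)

  covers-orients : (ε : Edge) (a c b d : Fin n) →
    Covers ε (a , c) (b , d) ⇔ (Orients (a , b) (proj₁ ε) × Orients (c , d) (proj₁ ε))
  covers-orients ((i , j) , _) a c b d = mk⇔
    (λ t → let (tab , tcd) = ∧-elim {edgeTest i j a b} t in
           Equivalence.to (edgeTest-orients i j a b) tab , Equivalence.to (edgeTest-orients i j c d) tcd)
    (λ (ab , cd) → ∧-intro (Equivalence.from (edgeTest-orients i j a b) ab) (Equivalence.from (edgeTest-orients i j c d) cd))

  covers⇒linked : (ε : Edge) {x y : Pair} → Covers ε x y → Linked x y
  covers⇒linked ε {a , c} {b , d} cov =
    let (ab , cd) = Equivalence.to (covers-orients ε a c b d) cov in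
    adj-orients ab (edge-adjacent ε) , orients-trans cd (orients-sym ab)

  linked⇒covers : {x y : Pair} → Linked x y → Σ[ ε ∈ Edge ] Covers ε x y
  linked⇒covers {a , c} {b , d} (t , cd) =
    let (ε , ab) = edge-of t in ε , Equivalence.from (covers-orients ε a c b d) (ab , orients-trans cd ab)

  covers-unique : {k k' : Fin m} {x y : Pair} → Covers (edgeAt k) x y → Covers (edgeAt k') x y → k ≡ k'
  covers-unique {k} {k'} {a , c} {b , d} cov cov' =
    edgeAt-unique (orients-trans (orients-sym (proj₁ (Equivalence.to (covers-orients (edgeAt k) a c b d) cov)))
                                 (proj₁ (Equivalence.to (covers-orients (edgeAt k') a c b d) cov')))

  -- By uniqueness of the covering edge, the 2-sum over all edges is Linked.
  edgeTerms : List (Graph (Fin n) × Graph (Fin n))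
  edgeTerms = tabulate (λ k → gadget (edgeAt k) , gadget (edgeAt k))

  twoSum-linked : (x y : Pair) → T (twoSumAdj edgeTerms x y) ⇔ Linked x y
  twoSum-linked x y = mk⇔
    (λ t → let (k , cov) = xor-tabulate⇒ f h t in covers⇒linked (edgeAt k) cov)
    (λ l → let (ε , cov) = linked⇒covers l in
           xor-tabulate⇐ f h (λ _ _ → covers-unique {x = x} {y})
             (Inverse.to edge↔ ε , subst (λ ε → Covers ε x y) (≡-sym (Inverse.strictlyInverseʳ edge↔ ε)) cov))
    where
    f : Graph (Fin n) × Graph (Fin n) → Bool
    f (H , H') = tensorAdj H H' x y
    h : Fin m → Graph (Fin n) × Graph (Fin n)
    h k = gadget (edgeAt k) , gadget (edgeAt k)

  vertex-edge : (k : Fin m) (β : Bool) → vertex (inj₂ (inj₁ (k , β))) ≡ orient β (proj₁ (edgeAt k))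
  vertex-edge k false = refl
  vertex-edge k true  = refl

  vertex-offdiag : (v : (Fin m × Bool) ⊎ Fin (n * n ∸ n ∸ 2 * m)) → OffDiagonal (vertex (inj₂ v))
  vertex-offdiag (inj₁ (k , β)) = subst OffDiagonal (≡-sym (vertex-edge k β)) (orient-offdiag β (edge-offdiag (edgeAt k)))
  vertex-offdiag (inj₂ k)       = proj₁ (rest-pair (Inverse.from rest↔ k))

  rest-isolated : (k : Fin (n * n ∸ n ∸ 2 * m)) {y : Pair} → ¬ Linked (vertex (inj₂ (inj₂ k))) y
  rest-isolated k l =
    proj₂ (rest-pair (Inverse.from rest↔ k)) (proj₂ (Linked-offdiag (vertex-offdiag (inj₂ k)) l))

  edges-linked : (k k' : Fin m) (β β' : Bool) →
    Linked (orient β (proj₁ (edgeAt k))) (orient β' (proj₁ (edgeAt k'))) ⇔ (k' ≡ k × β' ≡ not β)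
  edges-linked k k' β β' = mk⇔ to (λ { (refl , refl) → orientations-linked (edgeAt k) β })
    where
    p : Pair
    p = proj₁ (edgeAt k)
    to : Linked (orient β p) (orient β' (proj₁ (edgeAt k'))) → k' ≡ k × β' ≡ not β
    to l with trans (proj₁ (Linked-offdiag (orient-offdiag β (edge-offdiag (edgeAt k))) l)) (orient-swap β p)
    ... | eq with edgeAt-unique (orients-of-≡ β' (not β) eq)
    ...   | refl = refl , orient-cancel β' (not β) (edge-offdiag (edgeAt k)) eq

  union-linked : (w w' : UnionV n m) → T (unionAdj G m w w') ⇔ Linked (vertex w) (vertex w')
  union-linked (inj₁ a) (inj₁ b) = mk⇔ (λ t → t , false , refl) proj₁
  union-linked (inj₁ a) (inj₂ v) = mk⇔ (λ ()) (λ l → Linked-diag l (vertex-offdiag v))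
  union-linked (inj₂ (inj₁ e)) (inj₁ a) = mk⇔ (λ ()) (λ l → Linked-diag (Linked-sym l) (vertex-offdiag (inj₁ e)))
  union-linked (inj₂ (inj₁ (k , β))) (inj₂ (inj₁ (k' , β'))) =
    ⇔-trans (k₂-adjacency k k' β β')
      (⇔-sym (subst₂ (λ u v → Linked u v ⇔ (k' ≡ k × β' ≡ not β))
                     (≡-sym (vertex-edge k β)) (≡-sym (vertex-edge k' β')) (edges-linked k k' β β')))
  union-linked (inj₂ (inj₁ _)) (inj₂ (inj₂ k)) = mk⇔ (λ ()) (λ l → rest-isolated k (Linked-sym l))
  union-linked (inj₂ (inj₂ k)) w'               = mk⇔ (λ ()) (rest-isolated k)

  union-linked-at : (x y : Pair) →
    T (unionAdj G m (Inverse.to vertices↔ x) (Inverse.to vertices↔ y)) ⇔ Linked x y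
  union-linked-at x y = subst₂ (λ u v → T (unionAdj G m (Inverse.to vertices↔ x) (Inverse.to vertices↔ y)) ⇔ Linked u v)
      (Inverse.strictlyInverseʳ vertices↔ x) (Inverse.strictlyInverseʳ vertices↔ y)
      (union-linked (Inverse.to vertices↔ x) (Inverse.to vertices↔ y))

  -- The 2-sum K, padded in front by two cancelling copies of the square of K₂(i₀,j₀)
  -- so that the list of summands is nonempty even if G has no edges.
  module Padded (i₀ j₀ : Fin n) (i₀≢j₀ : i₀ ≢ j₀) where

    padding : Graph (Fin n) × Graph (Fin n)
    padding = edgeGraph i₀ j₀ i₀≢j₀ , edgeGraph i₀ j₀ i₀≢j₀

    K : Graph Pair
    K = twoSumGraph (padding ∷ padding ∷ edgeTerms)

    K∈𝒦 : InK n n K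
    K∈𝒦 = padding , padding ∷ edgeTerms , (nt ∷ nt ∷ tabulate⁺ (λ k → gadget-nt (edgeAt k))) , λ _ _ → refl
      where
      nt : Nontrivial (proj₁ padding) × Nontrivial (proj₂ padding)
      nt = edgeGraph-nontrivial i₀≢j₀ , edgeGraph-nontrivial i₀≢j₀
      gadget-nt : (ε : Edge) → Nontrivial (gadget ε) × Nontrivial (gadget ε)
      gadget-nt ε = edgeGraph-nontrivial (edge-offdiag ε) , edgeGraph-nontrivial (edge-offdiag ε)

    same-adjacency : (x y : Pair) → adj K x y ≡ unionAdj G m (Inverse.to vertices↔ x) (Inverse.to vertices↔ y)
    same-adjacency x y = trans (twoSum-cancel padding edgeTerms x y)
      (T-⇔⇒≡ (⇔-trans (twoSum-linked x y) (⇔-sym (union-linked-at x y))))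

    K≅union : IsoTo K (unionAdj G m)
    K≅union = vertices↔ , same-adjacency

-- The theorem: for n ≥ 2 take the padding on the vertices 0 ≠ 1.
theorem3 : (n : ℕ) → 2 ≤ n → (G : Graph (Fin n)) →
    ∃[ K ] (InK n n K × IsoTo K (unionAdj G (numEdges G)))
theorem3 (suc (suc _)) (s≤s (s≤s z≤n)) G = K , K∈𝒦 , K≅union
  where open Construction.Padded G zero (suc zero) (λ ())
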